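{- Every colored graph is 2-connected, i.e. it cannot be disconnected by removing a single vertex.
   Context: A colored graph (for an integer $D\ge3$) is a finite connected bipartite multigraph (black and white vertices, multiple edges allowed) whose edges are colored in $\{0,1,\dots,D\}$ so that every vertex is incident to exactly one edge of each color. -}

module Defs where

open import Data.Nat using (ℕ; suc)
open import Data.Fin using (Fin)
open import Data.Bool using (Bool; true; false)
open import Data.Product using (Σ; _×_)
open import Data.Sum using (_⊎_)
open import Relation.Binary.PropositionalEquality using (_≡_; _≢_)
open import Relation.Binary.Construct.Closure.ReflexiveTransitive using (Star)

-- Edges: Fin nE (so multiple
-- edges are allowed).
record ColouredMultigraph (D : ℕ) : Set where
  field
    nV      : ℕ
    nE      : ℕ
    isBlack : Fin nV → Bool
    blk     : Fin nE → Fin nV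
    wht     : Fin nE → Fin nV
    colour  : Fin nE → Fin (suc D)
    blk-black : ∀ e → isBlack (blk e) ≡ true
    wht-white : ∀ e → isBlack (wht e) ≡ false

  Incident : Fin nE → Fin nV → Set
  Incident e v = blk e ≡ v ⊎ wht e ≡ v

  Adj : Fin nV → Fin nV → Set
  Adj u v = Σ (Fin nE) λ e → (blk e ≡ u × wht e ≡ v) ⊎ (blk e ≡ v × wht e ≡ u)

  AdjAvoiding : Fin nV → Fin nV → Fin nV → Set
  AdjAvoiding x u v = Adj u v × u ≢ x × v ≢ x

  Connected : Set
  Connected = ∀ u v → Star Adj u v

  ProperlyColoured : Set
  ProperlyColoured =
    ∀ (v : Fin nV) (c : Fin (suc D)) →
      Σ (Fin nE) λ e → (Incident e v × colour e ≡ c) ×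
        (∀ e′ → Incident e′ v → colour e′ ≡ c → e′ ≡ e)

record ColoredGraph (D : ℕ) : Set where
  field
    graph     : ColouredMultigraph D
    connected : ColouredMultigraph.Connected graph
    proper    : ColouredMultigraph.ProperlyColoured graph
  open ColouredMultigraph graph public

TwoConnected : ∀ {D} → ColoredGraph D → Set
TwoConnected G =
  ∀ (x u v : Fin nV) → u ≢ x → v ≢ x → Star (AdjAvoiding x) u v
  where open ColoredGraph G

-- Fix a vertex x and two neighbours a, b of x, reached along edges of colours c and c′.
-- Alternating the colours c and c′ is a permutation σ = nbr c′ ∘ nbr c of the vertices,
-- so the orbit of x under σ returns to x. Following that orbit from x steps through the
-- {c, c′}-bicoloured cycle of x, which runs from a to b without passing through x again:
-- every orbit point has the colour class of x, and every intermediate vertex the other.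
-- Replacing each visit to x in a path by such a detour proves 2-connectivity.
-- Only two colours are ever used.
module Submission where

open import Defs
open import Data.Nat using (ℕ; _≤_; zero; suc; _+_)
open import Data.Nat.GeneralisedArithmetic using (fold; fold-+)
open import Data.Nat.Properties using (m≤n⇒∃[o]m+o≡n; +-suc; n<1+n)
open import Data.Fin using (Fin; toℕ; _≟_)
open import Data.Fin.Properties using (pigeonhole)
open import Data.Bool using (not)
open import Data.Bool.Properties using (not-¬; not-involutive)
open import Data.Product using (∃-syntax; _×_; _,_; proj₁; proj₂)
open import Data.Sum using (_⊎_; inj₁; inj₂)
open import Data.Empty using (⊥-elim)
open import Function.Definitions using (Injective)
import Level
open import Relation.Nullary using (yes; no)
open import Relation.Binary.Core using (Rel)
open import Relation.Binary.Definitions using (DecidableEquality)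
open import Relation.Binary.PropositionalEquality
open import Relation.Binary.Construct.Closure.ReflexiveTransitive using (Star; ε; _◅_; _◅◅_)

fold-injective : ∀ {a} {A : Set a} {f : A → A} → Injective _≡_ _≡_ f →
                 ∀ k {y z} → fold y f k ≡ fold z f k → y ≡ z
fold-injective f-inj zero    eq = eq
fold-injective f-inj (suc k) eq = fold-injective f-inj k (f-inj eq)

fold-periodic : ∀ {n} {f : Fin n → Fin n} → Injective _≡_ _≡_ f →
                ∀ x → ∃[ d ] fold x f (suc d) ≡ x
fold-periodic {n} {f} f-inj x
  with i , j , i<j , eq ← pigeonhole (n<1+n n) (λ i → fold x f (toℕ i))
  with o , i+o≡j ← m≤n⇒∃[o]m+o≡n i<j
  = o , sym (fold-injective f-inj (toℕ i) (begin
      fold x f (toℕ i)                    ≡⟨ eq ⟩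
      fold x f (toℕ j)                    ≡⟨ cong (fold x f) (trans (sym i+o≡j) (sym (+-suc (toℕ i) o))) ⟩
      fold x f (toℕ i + suc o)            ≡⟨ fold-+ x f (toℕ i) ⟩
      fold (fold x f (suc o)) f (toℕ i)   ∎))
  where open ≡-Reasoning

module _ {a ℓ} {A : Set a} (_≟A_ : DecidableEquality A) (R : Rel A ℓ) (x : A) where

  Avoiding : Rel A (a Level.⊔ ℓ)
  Avoiding u v = R u v × u ≢ x × v ≢ x

  star-avoiding : (∀ {b} → R x b → b ≢ x) →
                  (∀ {a b} → R a x → R x b → Star Avoiding a b) →
                  ∀ {u v} → Star R u v → u ≢ x → v ≢ x → Star Avoiding u v
  star-avoiding no-loop detour ε u≢x v≢x = ε
  star-avoiding no-loop detour (_◅_ {j = w} uw wv) u≢x v≢x with w ≟A x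
  ... | no w≢x = (uw , u≢x , w≢x) ◅ star-avoiding no-loop detour wv w≢x v≢x
  ... | yes refl with wv
  ...   | ε       = ⊥-elim (v≢x refl)
  ...   | xb ◅ bv = detour uw xb ◅◅ star-avoiding no-loop detour bv (no-loop xb) v≢x

module ProperColouring {D : ℕ} (M : ColouredMultigraph D)
                       (proper : ColouredMultigraph.ProperlyColoured M) where
  open ColouredMultigraph M

  Joins : Fin nE → Fin nV → Fin nV → Set
  Joins e u v = (blk e ≡ u × wht e ≡ v) ⊎ (blk e ≡ v × wht e ≡ u)

  joins-sym : ∀ {e u v} → Joins e u v → Joins e v u
  joins-sym (inj₁ j) = inj₂ j
  joins-sym (inj₂ j) = inj₁ j

  joins-incident : ∀ {e u v} → Joins e u v → Incident e v
  joins-incident (inj₁ (_ , wht≡v)) = inj₂ wht≡v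
  joins-incident (inj₂ (blk≡v , _)) = inj₁ blk≡v

  joins-isBlack : ∀ {e u v} → Joins e u v → isBlack v ≡ not (isBlack u)
  joins-isBlack {e} (inj₁ (refl , refl)) rewrite blk-black e | wht-white e = refl
  joins-isBlack {e} (inj₂ (refl , refl)) rewrite blk-black e | wht-white e = refl

  joins-distinct : ∀ {e u v} → Joins e u v → u ≢ v
  joins-distinct j refl = not-¬ refl (joins-isBlack j)

  other : ∀ e v → Incident e v → Fin nV
  other e v (inj₁ _) = wht e
  other e v (inj₂ _) = blk e

  joins-other : ∀ e v (i : Incident e v) → Joins e (other e v i) v
  joins-other e v (inj₁ blk≡v) = inj₂ (blk≡v , refl)
  joins-other e v (inj₂ wht≡v) = inj₁ (refl , wht≡v)

  other-unique : ∀ {e u v} → Joins e u v → (i : Incident e v) → other e v i ≡ u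
  other-unique (inj₁ (blk≡u , wht≡v)) (inj₁ blk≡v) =
    ⊥-elim (joins-distinct (inj₁ (refl , refl)) (trans blk≡v (sym wht≡v)))
  other-unique (inj₂ (_ , wht≡u))     (inj₁ _)     = wht≡u
  other-unique (inj₁ (blk≡u , _))     (inj₂ _)     = blk≡u
  other-unique (inj₂ (blk≡v , wht≡u)) (inj₂ wht≡v) =
    ⊥-elim (joins-distinct (inj₁ (refl , refl)) (trans blk≡v (sym wht≡v)))

  edge : Fin (suc D) → Fin nV → Fin nE
  edge c v = proj₁ (proper v c)

  edge-incident : ∀ c v → Incident (edge c v) v
  edge-incident c v = proj₁ (proj₁ (proj₂ (proper v c)))

  colour-edge : ∀ c v → colour (edge c v) ≡ c
  colour-edge c v = proj₂ (proj₁ (proj₂ (proper v c)))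

  nbr : Fin (suc D) → Fin nV → Fin nV
  nbr c v = other (edge c v) v (edge-incident c v)

  joins-nbr : ∀ c v → Joins (edge c v) (nbr c v) v
  joins-nbr c v = joins-other (edge c v) v (edge-incident c v)

  adj-nbr : ∀ c v → Adj v (nbr c v)
  adj-nbr c v = edge c v , joins-sym (joins-nbr c v)

  isBlack-nbr : ∀ c v → isBlack (nbr c v) ≡ not (isBlack v)
  isBlack-nbr c v = trans (sym (not-involutive _)) (cong not (sym (joins-isBlack (joins-nbr c v))))

  nbr-colour : ∀ {e u v} → Joins e u v → nbr (colour e) v ≡ u
  nbr-colour {e} {u} {v} j with proper v (colour e)
  ... | e′ , (i , _) , unique with unique e (joins-incident j) refl
  ... | refl = other-unique j i

  nbr-involutive : ∀ c v → nbr c (nbr c v) ≡ v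
  nbr-involutive c v =
    subst (λ c′ → nbr c′ (nbr c v) ≡ v) (colour-edge c v) (nbr-colour (joins-sym (joins-nbr c v)))

  module Bicoloured (x : Fin nV) (c c′ : Fin (suc D)) where

    σ : Fin nV → Fin nV
    σ v = nbr c′ (nbr c v)

    σ-injective : Injective _≡_ _≡_ σ
    σ-injective {y} {z} σy≡σz = begin
      y                      ≡⟨ sym (nbr-involutive c y) ⟩
      nbr c (nbr c y)        ≡⟨ cong (nbr c) (sym (nbr-involutive c′ (nbr c y))) ⟩
      nbr c (nbr c′ (σ y))   ≡⟨ cong (λ w → nbr c (nbr c′ w)) σy≡σz ⟩
      nbr c (nbr c′ (σ z))   ≡⟨ cong (nbr c) (nbr-involutive c′ (nbr c z)) ⟩
      nbr c (nbr c z)        ≡⟨ nbr-involutive c z ⟩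
      z                      ∎
      where open ≡-Reasoning

    nbr-σ⁻¹ : ∀ {y} → σ y ≡ x → nbr c y ≡ nbr c′ x
    nbr-σ⁻¹ {y} σy≡x = trans (sym (nbr-involutive c′ (nbr c y))) (cong (nbr c′) σy≡x)

    orbit : ℕ → Fin nV
    orbit = fold x σ

    isBlack-orbit : ∀ k → isBlack (orbit k) ≡ isBlack x
    isBlack-orbit zero    = refl
    isBlack-orbit (suc k) = begin
      isBlack (σ (orbit k))           ≡⟨ isBlack-nbr c′ _ ⟩
      not (isBlack (nbr c (orbit k))) ≡⟨ cong not (isBlack-nbr c _) ⟩
      not (not (isBlack (orbit k)))   ≡⟨ not-involutive _ ⟩
      isBlack (orbit k)               ≡⟨ isBlack-orbit k ⟩
      isBlack x                       ∎
      where open ≡-Reasoning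

    nbr-orbit-≢ : ∀ d k → nbr d (orbit k) ≢ x
    nbr-orbit-≢ d k eq = not-¬ (sym (isBlack-orbit k)) (begin
      isBlack x                     ≡⟨ cong isBlack (sym eq) ⟩
      isBlack (nbr d (orbit k))     ≡⟨ isBlack-nbr d (orbit k) ⟩
      not (isBlack (orbit k))       ∎)
      where open ≡-Reasoning

    -- The second disjunct persists until the orbit first returns to x, which yields the first.
    walk : ∀ k → Star (AdjAvoiding x) (nbr c x) (nbr c′ x)
               ⊎ Star (AdjAvoiding x) (nbr c x) (nbr c (orbit k))
    walk zero = inj₂ ε
    walk (suc k) with walk k
    ... | inj₁ done = inj₁ done
    ... | inj₂ path with orbit (suc k) ≟ x
    ...   | yes returned = inj₁ (subst (Star (AdjAvoiding x) (nbr c x)) (nbr-σ⁻¹ returned) path)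
    ...   | no ≢x = inj₂ (path ◅◅ step₁ ◅ step₂ ◅ ε)
      where
      step₁ : AdjAvoiding x (nbr c (orbit k)) (orbit (suc k))
      step₁ = adj-nbr c′ (nbr c (orbit k)) , nbr-orbit-≢ c k , ≢x
      step₂ : AdjAvoiding x (orbit (suc k)) (nbr c (orbit (suc k)))
      step₂ = adj-nbr c (orbit (suc k)) , ≢x , nbr-orbit-≢ c (suc k)

    bicoloured-path : Star (AdjAvoiding x) (nbr c x) (nbr c′ x)
    bicoloured-path with d , returned ← fold-periodic σ-injective x with walk d
    ... | inj₁ path = path
    ... | inj₂ path = subst (Star (AdjAvoiding x) (nbr c x)) (nbr-σ⁻¹ returned) path

  detour : ∀ {x a b} → Adj a x → Adj x b → Star (AdjAvoiding x) a b
  detour {x} (e , ax) (f , xb) =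
    subst₂ (Star (AdjAvoiding x)) (nbr-colour ax) (nbr-colour (joins-sym xb))
      (Bicoloured.bicoloured-path x (colour e) (colour f))

lemma1 : (D : ℕ) → 3 ≤ D → (G : ColoredGraph D) → TwoConnected G
lemma1 D _ G x u v u≢x v≢x =
  star-avoiding _≟_ Adj x
    (λ (_ , xb) b≡x → joins-distinct xb (sym b≡x))
    detour
    (connected u v) u≢x v≢x
  where
  open ColoredGraph G
  open ProperColouring graph proper
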